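{- Let $\Omega$ be a set with $|\Omega|=5$ and let $G_1,G_2\in\mathcal{C}_5\cup\mathcal{K}_{2,3}$. If $\mathcal{D}(G_1)\leqslant\mathcal{D}(G_2)$, then $\mathcal{D}(G_1)=\mathcal{D}(G_2)$.
   Context: Graphs are finite, simple, undirected; $\mathcal{D}(G)$ is the family of inclusion-minimal dominating sets of $G$ (a dominating set is $D\subseteq V(G)$ such that every vertex outside $D$ has a neighbour in $D$). $\mathcal{C}_5$ is the family of graphs with vertex set $\Omega$ isomorphic to the cycle $C_5$; $\mathcal{K}_{2,3}$ is the family of graphs with vertex set $\Omega$ isomorphic to $K_{2,3}$. $\mathcal{H}_1\leqslant\mathcal{H}_2$ means: for every $A_1\in\mathcal{H}_1$ there is $A_2\in\mathcal{H}_2$ with $A_2\subseteq A_1$. -}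

module Defs where

open import Data.Bool using (Bool; true; false; _∨_; _xor_)
open import Data.Nat using (ℕ; _+_; _%_; _≡ᵇ_; _<ᵇ_)
open import Data.Fin using (Fin; toℕ)
open import Data.Sum using (_⊎_)
open import Data.Product using (Σ; ∃; _×_; _,_)
open import Relation.Binary.PropositionalEquality using (_≡_)
open import Function.Bundles using (_↔_; Inverse; _⇔_)

record Graph (Ω : Set) : Set where
  field
    adj    : Ω → Ω → Bool
    sym    : ∀ x y → adj x y ≡ adj y x
    irrefl : ∀ x → adj x x ≡ false
open Graph public

Subset : Set → Set
Subset Ω = Ω → Bool

_⊆_ : {Ω : Set} → Subset Ω → Subset Ω → Set
A ⊆ B = ∀ v → A v ≡ true → B v ≡ true

Dominating : {Ω : Set} → Graph Ω → Subset Ω → Set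
Dominating G D = ∀ v → D v ≡ false → ∃ λ u → D u ≡ true × adj G v u ≡ true

-- D ∈ 𝒟(G): D is an inclusion-minimal dominating set
-- (every dominating subset of D contains D, i.e. equals D).
MinDom : {Ω : Set} → Graph Ω → Subset Ω → Set
MinDom G D = Dominating G D × (∀ D' → D' ⊆ D → Dominating G D' → D ⊆ D')

c5adj : Fin 5 → Fin 5 → Bool
c5adj i j = (((toℕ i + 1) % 5) ≡ᵇ toℕ j) ∨ (((toℕ j + 1) % 5) ≡ᵇ toℕ i)

-- Adjacency of the reference K₂,₃ on Fin 5: parts {0,1} and {2,3,4}.
k23adj : Fin 5 → Fin 5 → Bool
k23adj i j = (toℕ i <ᵇ 2) xor (toℕ j <ᵇ 2)

IsoTo : {Ω : Set} → Graph Ω → (Fin 5 → Fin 5 → Bool) → Set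
IsoTo {Ω} G h = Σ (Ω ↔ Fin 5) λ f →
  ∀ x y → adj G x y ≡ h (Inverse.to f x) (Inverse.to f y)

InC5orK23 : {Ω : Set} → Graph Ω → Set
InC5orK23 G = IsoTo G c5adj ⊎ IsoTo G k23adj

_≤𝒟_ : {Ω : Set} → Graph Ω → Graph Ω → Set
G₁ ≤𝒟 G₂ = ∀ A₁ → MinDom G₁ A₁ → ∃ λ A₂ → MinDom G₂ A₂ × A₂ ⊆ A₁

_=𝒟_ : {Ω : Set} → Graph Ω → Graph Ω → Set
G₁ =𝒟 G₂ = ∀ A → MinDom G₁ A ⇔ MinDom G₂ A

-- In C₅ and in K₂,₃ no vertex is adjacent to all others, so every dominating
-- pair of vertices is a minimal dominating set. Hence 𝒟(G₁) ≤ 𝒟(G₂) says in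
-- particular that every dominating pair of G₁ also dominates G₂. The dominating
-- pairs of C₅ are its five non-edges, those of K₂,₃ are all pairs except the
-- three inside the larger part; an exhaustive check over all maps
-- Fin 5 → Fin 5 shows that such an inclusion between the dominating pairs of
-- a reference graph and a relabelled one forces the two adjacencies to agree.
-- So G₁ = G₂, and in particular 𝒟(G₁) = 𝒟(G₂).
module Submission where

open import Defs hiding (sym)
open import Data.Fin using (Fin)
open import Data.Nat using (ℕ)
open import Data.Bool using (Bool; true; false)
import Data.Bool as Bool
import Data.Fin as Fin
open import Data.Fin.Properties using (all?; any?)
open import Data.Product using (∃; _×_; _,_; proj₁; proj₂)
open import Data.Sum using (_⊎_; inj₁; inj₂; map; map₂; swap)
open import Data.Vec using (_∷_; []; lookup)
open import Data.Vec.Properties using (lookup∘tabulate)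
open import Function.Base using (_on_; _∘_)
open import Function.Bundles using (_↔_; Inverse; Injection; _⇔_; mk⇔; Equivalence)
open import Function.Properties.Inverse using (↔-sym; ↔-refl; ↔⇒↣)
open import Relation.Binary.Definitions using (DecidableEquality)
open import Relation.Binary.PropositionalEquality
  using (_≡_; _≢_; _≗_; refl; sym; trans; cong; cong₂; subst; module ≡-Reasoning)
open import Relation.Nullary.Decidable
  using (Dec; yes; no; does; _⊎-dec_; _×-dec_; _→-dec_; ¬?; dec-true; from-yes; via-injection)
open import Relation.Nullary.Negation using (¬_; contradiction)

private
  variable
    A B Ω : Set
    R S R′ S′ : A → A → Bool
    x y : A
    G H : Graph Ω
    D E : Subset Ω

_≗₂_ : (A → A → Bool) → (A → A → Bool) → Set
R ≗₂ S = ∀ x y → R x y ≡ S x y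

PairDominates : (A → A → Bool) → A → A → Set
PairDominates R x y = ∀ v → v ≡ x ⊎ v ≡ y ⊎ R v x ≡ true ⊎ R v y ≡ true

Refines : (A → A → Bool) → (A → A → Bool) → Set
Refines R S = ∀ x y → PairDominates R x y → PairDominates S x y

NoUniversalVertex : (A → A → Bool) → Set
NoUniversalVertex R = ∀ x → ∃ λ y → y ≢ x × R y x ≡ false

module _ (g : A ↔ B) where
  open Inverse g

  to-injective : ∀ {u v} → to u ≡ to v → u ≡ v
  to-injective = Injection.injective (↔⇒↣ g)

  pairDominates-pullback : S ≗₂ (R on to) → PairDominates S x y ⇔ PairDominates R (to x) (to y)
  pairDominates-pullback {S = S} {R = R} {x = x} {y = y} S≗R = mk⇔ push pull
    where
    push : PairDominates S x y → PairDominates R (to x) (to y)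
    push pd w = map moved (map moved (map adjacent adjacent)) (pd (from w))
      where
      moved : ∀ {z} → from w ≡ z → w ≡ to z
      moved eq = trans (sym (strictlyInverseˡ w)) (cong to eq)
      adjacent : ∀ {z} → S (from w) z ≡ true → R w (to z) ≡ true
      adjacent e = subst (λ u → R u _ ≡ true) (strictlyInverseˡ w) (trans (sym (S≗R _ _)) e)

    pull : PairDominates R (to x) (to y) → PairDominates S x y
    pull pd v = map to-injective (map to-injective (map adjacent adjacent)) (pd (to v))
      where
      adjacent : ∀ {z} → R (to v) (to z) ≡ true → S v z ≡ true
      adjacent = trans (S≗R _ _)

  refines-pullback : R′ ≗₂ (R on to) → S′ ≗₂ (S on to) → Refines R S → Refines R′ S′
  refines-pullback {R′ = R′} {R = R} {S′ = S′} {S = S} R′≗R S′≗S R⊑S x y =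
    Equivalence.from (pairDominates-pullback {S = S′} {R = S} S′≗S) ∘ R⊑S _ _ ∘
    Equivalence.to (pairDominates-pullback {S = R′} {R = R} R′≗R)

  noUniversalVertex-pullback : S ≗₂ (R on to) → NoUniversalVertex R → NoUniversalVertex S
  noUniversalVertex-pullback {S = S} {R = R} S≗R noUniversal x
    with noUniversal (to x)
  ... | m , m≢x , Rmx≡false = from m , from-m≢x , S-from-m-x≡false
    where
    from-m≢x : from m ≢ x
    from-m≢x eq = m≢x (trans (sym (strictlyInverseˡ m)) (cong to eq))
    S-from-m-x≡false : S (from m) x ≡ false
    S-from-m-x≡false =
      trans (S≗R _ _) (trans (cong (λ u → R u (to x)) (strictlyInverseˡ m)) Rmx≡false)

≗₂-sym : R ≗₂ S → S ≗₂ R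
≗₂-sym R≗S x y = sym (R≗S x y)

dominating-resp : adj G ≗₂ adj H → Dominating G D → Dominating H D
dominating-resp G≗H dom v v∉D with dom v v∉D
... | u , u∈D , vu∈G = u , u∈D , trans (sym (G≗H v u)) vu∈G

minDom-resp : adj G ≗₂ adj H → MinDom G D → MinDom H D
minDom-resp {G = G} {H = H} G≗H (dom , minimal) =
  dominating-resp {G = G} {H = H} G≗H dom ,
  λ D′ D′⊆D dom′ → minimal D′ D′⊆D (dominating-resp {G = H} {H = G} (≗₂-sym G≗H) dom′)

≗₂⇒=𝒟 : adj G ≗₂ adj H → G =𝒟 H
≗₂⇒=𝒟 {G = G} {H = H} G≗H D =
  mk⇔ (minDom-resp {G = G} {H = H} G≗H) (minDom-resp {G = H} {H = G} (≗₂-sym G≗H))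

dominating-mono : D ⊆ E → Dominating G D → Dominating G E
dominating-mono {D = D} D⊆E dom v v∉E with D v in v∈?D
... | true  = contradiction (trans (sym v∉E) (D⊆E v v∈?D)) λ ()
... | false with dom v v∈?D
...   | u , u∈D , vu∈G = u , D⊆E u u∈D , vu∈G

module _ (_≟_ : DecidableEquality Ω) where

  pair : Ω → Ω → Subset Ω
  pair x y v = does (v ≟ x ⊎-dec v ≟ y)

  ∈-pair⁺ : ∀ {x y v} → v ≡ x ⊎ v ≡ y → pair x y v ≡ true
  ∈-pair⁺ {x} {y} {v} = dec-true (v ≟ x ⊎-dec v ≟ y)

  ∈-pair⁻ : ∀ {x y v} → pair x y v ≡ true → v ≡ x ⊎ v ≡ y
  ∈-pair⁻ {x} {y} {v} v∈ with v ≟ x | v ≟ y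
  ... | yes v≡x | _       = inj₁ v≡x
  ... | no _    | yes v≡y = inj₂ v≡y

  ∉-pair : ∀ {x y v} → pair x y v ≡ false → v ≢ x × v ≢ y
  ∉-pair {x} {y} {v} v∉ with v ≟ x | v ≟ y
  ... | no v≢x | no v≢y = v≢x , v≢y

  pair-comm : ∀ {x y} → pair x y ⊆ pair y x
  pair-comm v = ∈-pair⁺ ∘ swap ∘ ∈-pair⁻

  dominating-pair⇔ : ∀ {x y} → Dominating G (pair x y) ⇔ PairDominates (adj G) x y
  dominating-pair⇔ {G = G} {x = x} {y = y} = mk⇔ pairDominates dominating
    where
    pairDominates : Dominating G (pair x y) → PairDominates (adj G) x y
    pairDominates dom v with pair x y v in v∈?
    ... | true = map₂ inj₁ (∈-pair⁻ v∈?)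
    ... | false with dom v v∈?
    ...   | u , u∈ , vu∈G with ∈-pair⁻ u∈
    ...     | inj₁ refl = inj₂ (inj₂ (inj₁ vu∈G))
    ...     | inj₂ refl = inj₂ (inj₂ (inj₂ vu∈G))

    dominating : PairDominates (adj G) x y → Dominating G (pair x y)
    dominating pd v v∉ with pd v
    ... | inj₁ v≡x              = contradiction v≡x (proj₁ (∉-pair v∉))
    ... | inj₂ (inj₁ v≡y)       = contradiction v≡y (proj₂ (∉-pair v∉))
    ... | inj₂ (inj₂ (inj₁ vx)) = x , ∈-pair⁺ (inj₁ refl) , vx
    ... | inj₂ (inj₂ (inj₂ vy)) = y , ∈-pair⁺ (inj₂ refl) , vy

  ⊆-singleton-not-dominating :
    NoUniversalVertex (adj G) → (∀ u → D u ≡ true → u ≡ y) → ¬ Dominating G D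
  ⊆-singleton-not-dominating {G = G} {D = D} {y = y} noUniversal only-y dom
    with noUniversal y
  ... | z , z≢y , zy∉G with D z in z∈?D
  ...   | true  = z≢y (only-y z z∈?D)
  ...   | false with dom z z∈?D
  ...     | u , u∈D , zu∈G =
    contradiction (trans (sym zy∉G) (subst (λ w → adj G z w ≡ true) (only-y u u∈D) zu∈G)) λ ()

  ∈-dominating-subpair :
    NoUniversalVertex (adj G) → ∀ {x y} → D ⊆ pair x y → Dominating G D → D x ≡ true
  ∈-dominating-subpair {G = G} {D = D} noUniversal {x} {y} D⊆pair dom with D x in x∈?D
  ... | true  = refl
  ... | false = contradiction dom (⊆-singleton-not-dominating {G = G} noUniversal only-y)
    where
    only-y : ∀ u → D u ≡ true → u ≡ y
    only-y u u∈D with ∈-pair⁻ (D⊆pair u u∈D)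
    ... | inj₁ refl = contradiction (trans (sym x∈?D) u∈D) λ ()
    ... | inj₂ u≡y  = u≡y

  pair-minimal : NoUniversalVertex (adj G) → ∀ {x y} → Dominating G (pair x y) → MinDom G (pair x y)
  pair-minimal {G = G} noUniversal dom =
    dom , λ D D⊆pair domD v v∈pair → ∈-pair-of D D⊆pair domD (∈-pair⁻ v∈pair)
    where
    ∈-pair-of : ∀ {x y} D → D ⊆ pair x y → Dominating G D → ∀ {v} → v ≡ x ⊎ v ≡ y → D v ≡ true
    ∈-pair-of D D⊆pair domD (inj₁ refl) = ∈-dominating-subpair {G = G} noUniversal D⊆pair domD
    ∈-pair-of D D⊆pair domD (inj₂ refl) =
      ∈-dominating-subpair {G = G} noUniversal (λ v → pair-comm v ∘ D⊆pair v) domD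

  ≤𝒟⇒refines : {G H : Graph Ω} → NoUniversalVertex (adj G) → G ≤𝒟 H → Refines (adj G) (adj H)
  ≤𝒟⇒refines {G = G} {H = H} noUniversal G≤H x y pd
    with G≤H (pair x y) (pair-minimal {G = G} noUniversal
                          (Equivalence.from (dominating-pair⇔ {G = G}) pd))
  ... | D , (domD , _) , D⊆pair =
    Equivalence.to (dominating-pair⇔ {G = H}) (dominating-mono {G = H} D⊆pair domD)

module _ {n : ℕ} where

  pairDominates? : (R : Fin n → Fin n → Bool) → ∀ i j → Dec (PairDominates R i j)
  pairDominates? R i j =
    all? λ v → v Fin.≟ i ⊎-dec v Fin.≟ j ⊎-dec R v i Bool.≟ true ⊎-dec R v j Bool.≟ true

  refines? : (R S : Fin n → Fin n → Bool) → Dec (Refines R S)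
  refines? R S = all? λ i → all? λ j → pairDominates? R i j →-dec pairDominates? S i j

  ≗₂? : (R S : Fin n → Fin n → Bool) → Dec (R ≗₂ S)
  ≗₂? R S = all? λ i → all? λ j → R i j Bool.≟ S i j

  noUniversalVertex? : (R : Fin n → Fin n → Bool) → Dec (NoUniversalVertex R)
  noUniversalVertex? R = all? λ x → any? λ y → ¬? (y Fin.≟ x) ×-dec R y x Bool.≟ false

  Rigid : (Fin n → Fin n → Bool) → (Fin n → Fin n → Bool) → (Fin n → Fin n) → Set
  Rigid h₁ h₂ σ = Refines h₁ (h₂ on σ) → h₁ ≗₂ (h₂ on σ)

  rigid? : ∀ h₁ h₂ σ → Dec (Rigid h₁ h₂ σ)
  rigid? h₁ h₂ σ = refines? h₁ (h₂ on σ) →-dec ≗₂? h₁ (h₂ on σ)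

  rigid-resp : ∀ {h₁ h₂ σ τ} → σ ≗ τ → Rigid h₁ h₂ τ → Rigid h₁ h₂ σ
  rigid-resp {h₁} {h₂} {σ} {τ} σ≗τ rigidτ h₁⊑h₂σ i j =
    trans (rigidτ (refines-pullback ↔-refl {R′ = h₁} {R = h₁} (λ _ _ → refl) τ≗σ h₁⊑h₂σ) i j)
          (τ≗σ i j)
    where
    τ≗σ : (h₂ on τ) ≗₂ (h₂ on σ)
    τ≗σ a b = cong₂ h₂ (sym (σ≗τ a)) (sym (σ≗τ b))

-- Maps Fin 5 → Fin 5 are enumerated through their tables of values.
rigid-of-tables : ∀ h₁ h₂ → (∀ a b c d e → Rigid h₁ h₂ (lookup (a ∷ b ∷ c ∷ d ∷ e ∷ []))) →
                  ∀ σ → Rigid h₁ h₂ σ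
rigid-of-tables h₁ h₂ rigid σ =
  rigid-resp {h₁ = h₁} {h₂} (sym ∘ lookup∘tabulate σ) (rigid _ _ _ _ _)

tables? : ∀ h₁ h₂ → Dec (∀ a b c d e → Rigid h₁ h₂ (lookup (a ∷ b ∷ c ∷ d ∷ e ∷ [])))
tables? h₁ h₂ = all? λ a → all? λ b → all? λ c → all? λ d → all? λ e → rigid? h₁ h₂ _

c5-noUniversalVertex : NoUniversalVertex c5adj
c5-noUniversalVertex = from-yes (noUniversalVertex? c5adj)

k23-noUniversalVertex : NoUniversalVertex k23adj
k23-noUniversalVertex = from-yes (noUniversalVertex? k23adj)

rigid-c5-c5 : ∀ σ → Rigid c5adj c5adj σ
rigid-c5-c5 = rigid-of-tables c5adj c5adj (from-yes (tables? c5adj c5adj))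

rigid-c5-k23 : ∀ σ → Rigid c5adj k23adj σ
rigid-c5-k23 = rigid-of-tables c5adj k23adj (from-yes (tables? c5adj k23adj))

rigid-k23-c5 : ∀ σ → Rigid k23adj c5adj σ
rigid-k23-c5 = rigid-of-tables k23adj c5adj (from-yes (tables? k23adj c5adj))

rigid-k23-k23 : ∀ σ → Rigid k23adj k23adj σ
rigid-k23-k23 = rigid-of-tables k23adj k23adj (from-yes (tables? k23adj k23adj))

≤𝒟⇒≗₂ : ∀ {G₁ G₂ : Graph Ω} h₁ h₂ → NoUniversalVertex h₁ → (∀ σ → Rigid h₁ h₂ σ) →
        IsoTo G₁ h₁ → IsoTo G₂ h₂ → G₁ ≤𝒟 G₂ → adj G₁ ≗₂ adj G₂
≤𝒟⇒≗₂ {G₁ = G₁} {G₂} h₁ h₂ noUniversal rigid (f₁ , G₁≗h₁) (f₂ , G₂≗h₂) G₁≤G₂ x y = begin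
  adj G₁ x y                              ≡⟨ G₁≗h₁ x y ⟩
  h₁ (to₁ x) (to₁ y)                      ≡⟨ h₁≗h₂σ (to₁ x) (to₁ y) ⟩
  h₂ (σ (to₁ x)) (σ (to₁ y))              ≡⟨ G₂≗h₂ (from₁ (to₁ x)) (from₁ (to₁ y)) ⟨
  adj G₂ (from₁ (to₁ x)) (from₁ (to₁ y))  ≡⟨ cong₂ (adj G₂) (from₁∘to₁ x) (from₁∘to₁ y) ⟩
  adj G₂ x y                              ∎
  where
  open ≡-Reasoning
  open Inverse f₁ using ()
    renaming (to to to₁; from to from₁; strictlyInverseˡ to to₁∘from₁; strictlyInverseʳ to from₁∘to₁)

  σ : Fin 5 → Fin 5
  σ = Inverse.to f₂ ∘ from₁

  h₁≗G₁ : h₁ ≗₂ (adj G₁ on from₁)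
  h₁≗G₁ i j = trans (cong₂ h₁ (sym (to₁∘from₁ i)) (sym (to₁∘from₁ j))) (sym (G₁≗h₁ _ _))

  h₁≗h₂σ : h₁ ≗₂ (h₂ on σ)
  h₁≗h₂σ = rigid σ (refines-pullback (↔-sym f₁) h₁≗G₁ (λ i j → sym (G₂≗h₂ (from₁ i) (from₁ j)))
                     (≤𝒟⇒refines (via-injection (↔⇒↣ f₁) Fin._≟_) {G = G₁} {H = G₂}
                                  (noUniversalVertex-pullback f₁ G₁≗h₁ noUniversal) G₁≤G₂))

proposition4p15 : (Ω : Set) → Ω ↔ Fin 5 → (G₁ G₂ : Graph Ω) →
    InC5orK23 G₁ → InC5orK23 G₂ → G₁ ≤𝒟 G₂ → G₁ =𝒟 G₂
proposition4p15 _ _ G₁ G₂ G₁∈ G₂∈ G₁≤G₂ = ≗₂⇒=𝒟 {G = G₁} {H = G₂} (same-adjacency G₁∈ G₂∈)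
  where
  compare : ∀ h₁ h₂ → NoUniversalVertex h₁ → (∀ σ → Rigid h₁ h₂ σ) →
            IsoTo G₁ h₁ → IsoTo G₂ h₂ → adj G₁ ≗₂ adj G₂
  compare h₁ h₂ noUniversal rigid G₁≅h₁ G₂≅h₂ =
    ≤𝒟⇒≗₂ {G₁ = G₁} {G₂ = G₂} h₁ h₂ noUniversal rigid G₁≅h₁ G₂≅h₂ G₁≤G₂

  same-adjacency : InC5orK23 G₁ → InC5orK23 G₂ → adj G₁ ≗₂ adj G₂
  same-adjacency (inj₁ c₁) (inj₁ c₂) = compare c5adj  c5adj  c5-noUniversalVertex  rigid-c5-c5   c₁ c₂
  same-adjacency (inj₁ c₁) (inj₂ k₂) = compare c5adj  k23adj c5-noUniversalVertex  rigid-c5-k23  c₁ k₂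
  same-adjacency (inj₂ k₁) (inj₁ c₂) = compare k23adj c5adj  k23-noUniversalVertex rigid-k23-c5  k₁ c₂
  same-adjacency (inj₂ k₁) (inj₂ k₂) = compare k23adj k23adj k23-noUniversalVertex rigid-k23-k23 k₁ k₂
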